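{- Let $a>1$, $b>1$, $c>0$, $r>0$, $s>0$ be integers with $\gcd(ra,sb)=1$, and suppose the equation $(-1)^u r a^x + (-1)^v s b^y = c$ has two solutions $(x_1,y_1,u_1,v_1)$ and $(x_2,y_2,u_2,v_2)$ (nonnegative integers $x_i,y_i$, $u_i,v_i\in\{0,1\}$) with $x_1<x_2$. Then, if $r>1$ or $x_1>0$, we have $r a^{x_2}>c/2$; and if $r=1$ and $x_1=0$, we have $a^{x_2}>(c-2)/2$. -}

module Defs where

open import Data.Nat using (ℕ)
open import Data.Integer using (ℤ; +_; -_; _+_; _*_; _^_)
open import Relation.Binary.PropositionalEquality using (_≡_)

sgn : ℕ → ℤ
sgn u = (- (+ 1)) ^ u

-- (x , y , u , v) satisfies (-1)^u r a^x + (-1)^v s b^y = c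
-- (the constraint u , v ∈ {0,1} is imposed separately in the statement).
IsSol : (a b c r s x y u v : ℕ) → Set
IsSol a b c r s x y u v =
  sgn u * (+ r) * (+ a) ^ x + sgn v * (+ s) * (+ b) ^ y ≡ + c

{-# OPTIONS --safe #-}
-- Write P = r a^x₁ and Q = r a^x₂ = P A with A = a^(x₂ − x₁) ≥ 2, and Sᵢ = s b^yᵢ, so that the
-- solutions read ±P ± S₁ = c and ±Q ± S₂ = c.  The smaller m of S₁, S₂ divides the other and is
-- coprime to P; eliminating c shows m ∣ P (A ∓ 1), so m ≤ A + 1 unless a sign pattern already
-- forces c ≤ Q.  As c ≤ Sᵢ + Q for both i, we get c ≤ Q + A + 1, which is below 2Q when P ≥ 2
-- and equals 2A + 1 when P = 1.
module Submission where

open import Defs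
open import Data.Nat using (ℕ; zero; suc; _<_; _≤_; _+_; _*_; _^_; _∸_; z≤n; s≤s; >-nonZero)
open import Data.Nat.Properties
open import Data.Nat.Divisibility
  using (_∣_; ∣-trans; ∣-refl; m∣m*n; n∣m*n; ∣m+n∣m⇒∣n; ∣⇒≤; *-monoʳ-∣)
open import Data.Nat.Coprimality using (Coprime; coprime-divisor; gcd≡1⇒coprime; 1-coprimeTo)
import Data.Nat.Coprimality as Coprime
open import Data.Nat.GCD using (gcd)
open import Data.Nat.Tactic.RingSolver using (solve; solve-∀)
open import Data.Integer using (+_; _-_)
import Data.Integer as ℤ
import Data.Integer.Properties as ℤ
import Data.Integer.Tactic.RingSolver as ℤ-Solver
open import Data.List using (_∷_; [])
open import Data.Product using (_×_; _,_)
open import Data.Sum using (_⊎_; inj₁; inj₂)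
open import Relation.Binary.PropositionalEquality
  using (_≡_; _≢_; refl; sym; trans; cong; cong₂; subst; module ≡-Reasoning)

-- The three sign patterns of ±P ± S = c possible when c > 0.
data SignedSum (P S c : ℕ) : Set where
  P+S : P + S ≡ c → SignedSum P S c
  S-P : S ≡ c + P → SignedSum P S c
  P-S : P ≡ c + S → SignedSum P S c

pos-^ : ∀ a x → (+ a) ℤ.^ x ≡ + (a ^ x)
pos-^ a zero    = refl
pos-^ a (suc x) = trans (cong (+ a ℤ.*_) (pos-^ a x)) (sym (ℤ.pos-* a (a ^ x)))

-P+S≡c⇒S≡c+P : ∀ {P S c} → ℤ.- + P ℤ.+ + S ≡ + c → S ≡ c + P
-P+S≡c⇒S≡c+P {P} {S} {c} eq = ℤ.+-injective (begin
  + S                        ≡⟨ j≡[-i+j]+i (+ P) (+ S) ⟩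
  (ℤ.- + P ℤ.+ + S) ℤ.+ + P  ≡⟨ cong (ℤ._+ + P) eq ⟩
  + c ℤ.+ + P                ≡⟨ ℤ.pos-+ c P ⟨
  + (c + P)                  ∎)
  where
  open ≡-Reasoning
  j≡[-i+j]+i : ∀ i j → j ≡ (ℤ.- i ℤ.+ j) ℤ.+ i
  j≡[-i+j]+i = ℤ-Solver.solve-∀

-P-S≢1+c : ∀ P S c → ℤ.- + P ℤ.+ ℤ.- + S ≢ + suc c
-P-S≢1+c P S c eq =
  neg≢pos (P + S) (trans (cong ℤ.-_ (ℤ.pos-+ P S)) (trans (ℤ.neg-distrib-+ (+ P) (+ S)) eq))
  where
  neg≢pos : ∀ n → ℤ.- + n ≢ + suc c
  neg≢pos zero    ()
  neg≢pos (suc n) ()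

sgn-signedSum : ∀ {P S c} u v → u ≤ 1 → v ≤ 1 → 0 < c →
                sgn u ℤ.* + P ℤ.+ sgn v ℤ.* + S ≡ + c → SignedSum P S c
sgn-signedSum {P} {S} 0 0 _ _ _ eq =
  P+S (ℤ.+-injective (trans (ℤ.pos-+ P S)
                           (trans (sym (cong₂ ℤ._+_ (ℤ.*-identityˡ (+ P)) (ℤ.*-identityˡ (+ S)))) eq)))
sgn-signedSum {P} {S} 1 0 _ _ _ eq =
  S-P (-P+S≡c⇒S≡c+P (trans (sym (cong₂ ℤ._+_ (ℤ.-1*i≡-i (+ P)) (ℤ.*-identityˡ (+ S)))) eq))
sgn-signedSum {P} {S} 0 1 _ _ _ eq =
  P-S (-P+S≡c⇒S≡c+P (trans (ℤ.+-comm (ℤ.- + S) (+ P))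
                           (trans (sym (cong₂ ℤ._+_ (ℤ.*-identityˡ (+ P)) (ℤ.-1*i≡-i (+ S)))) eq)))
sgn-signedSum {P} {S} {suc c} 1 1 _ _ _ eq
  with () ← -P-S≢1+c P S c (trans (sym (cong₂ ℤ._+_ (ℤ.-1*i≡-i (+ P)) (ℤ.-1*i≡-i (+ S)))) eq)
sgn-signedSum (suc (suc _)) _ (s≤s ()) _ _ _
sgn-signedSum _ (suc (suc _)) _ (s≤s ()) _ _

isSol⇒signedSum : ∀ {a b c r s x y u v} → u ≤ 1 → v ≤ 1 → 0 < c →
                  IsSol a b c r s x y u v → SignedSum (r * a ^ x) (s * b ^ y) c
isSol⇒signedSum {a} {b} {c} {r} {s} {x} {y} {u} {v} u≤1 v≤1 0<c sol =
  sgn-signedSum u v u≤1 v≤1 0<c (trans (sym (cong₂ ℤ._+_ (term u r a x) (term v s b y))) sol)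
  where
  term : ∀ u r a x → sgn u ℤ.* + r ℤ.* (+ a) ℤ.^ x ≡ sgn u ℤ.* + (r * a ^ x)
  term u r a x = begin
    sgn u ℤ.* + r ℤ.* (+ a) ℤ.^ x    ≡⟨ ℤ.*-assoc (sgn u) (+ r) _ ⟩
    sgn u ℤ.* (+ r ℤ.* (+ a) ℤ.^ x)  ≡⟨ cong (λ z → sgn u ℤ.* (+ r ℤ.* z)) (pos-^ a x) ⟩
    sgn u ℤ.* (+ r ℤ.* + (a ^ x))    ≡⟨ cong (sgn u ℤ.*_) (ℤ.pos-* r (a ^ x)) ⟨
    sgn u ℤ.* + (r * a ^ x)          ∎
    where open ≡-Reasoning

coprime-∣ˡ : ∀ {d m n} → d ∣ m → Coprime m n → Coprime d n
coprime-∣ˡ d∣m c (i∣d , i∣n) = c (∣-trans i∣d d∣m , i∣n)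

coprime-∣ʳ : ∀ {d m n} → d ∣ n → Coprime m n → Coprime m d
coprime-∣ʳ d∣n c = Coprime.sym (coprime-∣ˡ d∣n (Coprime.sym c))

coprime-*ʳ : ∀ {m n o} → Coprime m n → Coprime m o → Coprime m (n * o)
coprime-*ʳ c₁ c₂ (i∣m , i∣no) = c₂ (i∣m , coprime-divisor (coprime-∣ˡ i∣m c₁) i∣no)

coprime-^ʳ : ∀ {m n} → Coprime m n → ∀ k → Coprime m (n ^ k)
coprime-^ʳ {m} c zero    = Coprime.sym (1-coprimeTo m)
coprime-^ʳ     c (suc k) = coprime-*ʳ c (coprime-^ʳ c k)

coprime-*^ʳ : ∀ {m n o} → Coprime m (n * o) → ∀ k → Coprime m (n * o ^ k)
coprime-*^ʳ {n = n} {o} c k =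
  coprime-*ʳ {n = n} (coprime-∣ʳ {n = n * o} (m∣m*n o) c) (coprime-^ʳ (coprime-∣ʳ (n∣m*n n) c) k)

coprime-*^ : ∀ {r a s b} → Coprime (r * a) (s * b) → ∀ x y → Coprime (s * b ^ y) (r * a ^ x)
coprime-*^ {r} {a} {s} {b} c x y =
  coprime-*^ʳ {n = r} {a} (Coprime.sym (coprime-*^ʳ {n = s} {b} c y)) x

^-monoʳ-∣ : ∀ b {m n} → m ≤ n → b ^ m ∣ b ^ n
^-monoʳ-∣ b {m} le with m≤n⇒∃[o]m+o≡n le
... | k , refl = subst (b ^ m ∣_) (sym (^-distribˡ-+-* b m k)) (m∣m*n (b ^ k))

*^-∣-total : ∀ s b m n → s * b ^ m ∣ s * b ^ n ⊎ s * b ^ n ∣ s * b ^ m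
*^-∣-total s b m n with ≤-total m n
... | inj₁ m≤n = inj₁ (*-monoʳ-∣ s (^-monoʳ-∣ b m≤n))
... | inj₂ n≤m = inj₂ (*-monoʳ-∣ s (^-monoʳ-∣ b n≤m))

signedSum-≤ : ∀ {P S c} → SignedSum P S c → c ≤ S + P
signedSum-≤ {P} {S} (P+S e) = ≤-reflexive (trans (sym e) (+-comm P S))
signedSum-≤ {P} {S} {c} (S-P e) = ≤-trans (m≤m+n c P) (≤-trans (≤-reflexive (sym e)) (m≤m+n S P))
signedSum-≤ {P} {S} {c} (P-S e) = ≤-trans (m≤m+n c S) (≤-trans (≤-reflexive (sym e)) (m≤n+m P S))

coprime-divisor-+ : ∀ {m P X Y k} → Coprime m P → m ∣ X → m ∣ Y → Y ≡ X + P * k → m ∣ k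
coprime-divisor-+ {m} c m∣X m∣Y refl = coprime-divisor c (∣m+n∣m⇒∣n m∣Y m∣X)

-- Eliminating c leaves S₁ and S₂ differing by P (A − 1) or P (A + 1), here with A = 2 + t.
common-divisor-≤ : ∀ {m P t S₁ S₂ c} → Coprime m P → m ∣ S₁ → m ∣ S₂ →
                   SignedSum P S₁ c → SignedSum (P * (2 + t)) S₂ c →
                   c ≤ P * (2 + t) ⊎ m ≤ 3 + t
common-divisor-≤ {P = P} {t} {S₁} {c = c} _ _ _ (P-S e₁) _ =
  inj₁ (≤-trans (m≤m+n c S₁) (≤-trans (≤-reflexive (sym e₁)) (m≤m*n P (2 + t))))
common-divisor-≤ {S₂ = S₂} {c} _ _ _ _ (P-S e₂) =
  inj₁ (≤-trans (m≤m+n c S₂) (≤-reflexive (sym e₂)))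
common-divisor-≤ {P = P} {t} {S₁} {S₂} {c} cop m∣S₁ m∣S₂ (P+S e₁) (P+S e₂) =
  inj₂ (≤-trans (∣⇒≤ (coprime-divisor-+ cop m∣S₂ m∣S₁ S₁≡S₂+P[1+t])) (m≤n+m (suc t) 2))
  where
  open ≡-Reasoning
  S₁≡S₂+P[1+t] : S₁ ≡ S₂ + P * suc t
  S₁≡S₂+P[1+t] = +-cancelˡ-≡ P S₁ (S₂ + P * suc t) (begin
    P + S₁                ≡⟨ e₁ ⟩
    c                     ≡⟨ e₂ ⟨
    P * (2 + t) + S₂      ≡⟨ solve (P ∷ t ∷ S₂ ∷ []) ⟩
    P + (S₂ + P * suc t)  ∎)
common-divisor-≤ {P = P} {t} {S₁} {S₂} {c} cop m∣S₁ m∣S₂ (P+S e₁) (S-P e₂) =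
  inj₂ (∣⇒≤ (coprime-divisor-+ cop m∣S₁ m∣S₂ (begin
    S₂                    ≡⟨ e₂ ⟩
    c + P * (2 + t)       ≡⟨ cong (_+ P * (2 + t)) e₁ ⟨
    P + S₁ + P * (2 + t)  ≡⟨ solve (P ∷ t ∷ S₁ ∷ []) ⟩
    S₁ + P * (3 + t)      ∎)))
  where open ≡-Reasoning
common-divisor-≤ {P = P} {t} {S₁} {S₂} {c} cop m∣S₁ m∣S₂ (S-P e₁) (P+S e₂) =
  inj₂ (∣⇒≤ (coprime-divisor-+ cop m∣S₂ m∣S₁ (begin
    S₁                    ≡⟨ e₁ ⟩
    c + P                 ≡⟨ cong (_+ P) e₂ ⟨
    P * (2 + t) + S₂ + P  ≡⟨ solve (P ∷ t ∷ S₂ ∷ []) ⟩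
    S₂ + P * (3 + t)      ∎)))
  where open ≡-Reasoning
common-divisor-≤ {P = P} {t} {S₁} {S₂} {c} cop m∣S₁ m∣S₂ (S-P e₁) (S-P e₂) =
  inj₂ (≤-trans (∣⇒≤ (coprime-divisor-+ cop m∣S₁ m∣S₂ (begin
    S₂                    ≡⟨ e₂ ⟩
    c + P * (2 + t)       ≡⟨ solve (c ∷ P ∷ t ∷ []) ⟩
    c + P + P * suc t     ≡⟨ cong (_+ P * suc t) e₁ ⟨
    S₁ + P * suc t        ∎))) (m≤n+m (suc t) 2))
  where open ≡-Reasoning

c≤P*A+1+A : ∀ {m P A S₁ S₂ c} → 2 ≤ A → Coprime m P → m ∣ S₁ → m ∣ S₂ → c ≤ m + P * A →
            SignedSum P S₁ c → SignedSum (P * A) S₂ c → c ≤ P * A + suc A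
c≤P*A+1+A {m} {P} {A} (s≤s (s≤s z≤n)) cop m∣S₁ m∣S₂ c≤m+PA σ₁ σ₂
  with common-divisor-≤ cop m∣S₁ m∣S₂ σ₁ σ₂
... | inj₁ c≤PA  = ≤-trans c≤PA (m≤m+n (P * A) (suc A))
... | inj₂ m≤1+A =
  ≤-trans c≤m+PA (≤-trans (+-monoˡ-≤ (P * A) m≤1+A) (≤-reflexive (+-comm (suc A) (P * A))))

signedSums-bound : ∀ {P A S₁ S₂ c} → 2 ≤ A → S₁ ∣ S₂ ⊎ S₂ ∣ S₁ → Coprime S₁ P → Coprime S₂ P →
                   SignedSum P S₁ c → SignedSum (P * A) S₂ c → c ≤ P * A + suc A
signedSums-bound {P} {A} {S₁} {c = c} 2≤A@(s≤s (s≤s z≤n)) (inj₁ S₁∣S₂) cop₁ _ σ₁ σ₂ =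
  c≤P*A+1+A 2≤A cop₁ ∣-refl S₁∣S₂ c≤S₁+PA σ₁ σ₂
  where
  c≤S₁+PA : c ≤ S₁ + P * A
  c≤S₁+PA = ≤-trans (signedSum-≤ σ₁) (+-monoʳ-≤ S₁ (m≤m*n P A))
signedSums-bound 2≤A (inj₂ S₂∣S₁) _ cop₂ σ₁ σ₂ =
  c≤P*A+1+A 2≤A cop₂ S₂∣S₁ ∣-refl (signedSum-≤ σ₂) σ₁ σ₂

*-^-∸ : ∀ r a {m n} → m ≤ n → r * a ^ n ≡ r * a ^ m * a ^ (n ∸ m)
*-^-∸ r a {m} {n} m≤n = begin
  r * a ^ n                  ≡⟨ cong (λ k → r * a ^ k) (m+[n∸m]≡n m≤n) ⟨
  r * a ^ (m + (n ∸ m))      ≡⟨ cong (r *_) (^-distribˡ-+-* a m (n ∸ m)) ⟩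
  r * (a ^ m * a ^ (n ∸ m))  ≡⟨ *-assoc r (a ^ m) (a ^ (n ∸ m)) ⟨
  r * a ^ m * a ^ (n ∸ m)    ∎
  where open ≡-Reasoning

2≤r*a^x : ∀ {r a x} → 0 < r → 1 < a → 1 < r ⊎ 0 < x → 2 ≤ r * a ^ x
2≤r*a^x {r} {a@(suc _)} {x} _   _   (inj₁ 1<r) = ≤-trans 1<r (m≤m*n r (a ^ x) {{m^n≢0 a x}})
2≤r*a^x {r} {a}         {x} 0<r 1<a (inj₂ 0<x) =
  ≤-trans (^-monoʳ-< a 1<a 0<x) (m≤n*m (a ^ x) r {{>-nonZero 0<r}})

1+n<m*n : ∀ {m n} → 2 ≤ m → 2 ≤ n → suc n < m * n
1+n<m*n {m} {n} 2≤m 2≤n = begin-strict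
  suc n   <⟨ n<1+n (suc n) ⟩
  2 + n   ≤⟨ +-monoˡ-≤ n 2≤n ⟩
  n + n   ≡⟨ solve (n ∷ []) ⟩
  2 * n   ≤⟨ *-monoˡ-≤ n 2≤m ⟩
  m * n   ∎
  where open ≤-Reasoning

n<k+m⇒n-k<m : ∀ {k m n} → n < k + m → + n - + k ℤ.< + m
n<k+m⇒n-k<m {k} {m} {n} n<k+m = begin-strict
  + n ℤ.+ ℤ.- + k          <⟨ ℤ.+-monoˡ-< (ℤ.- + k) (ℤ.+<+ n<k+m) ⟩
  + (k + m) ℤ.+ ℤ.- + k    ≡⟨ cong (ℤ._+ ℤ.- + k) (ℤ.pos-+ k m) ⟩
  + k ℤ.+ + m ℤ.+ ℤ.- + k  ≡⟨ i+j-i≡j (+ k) (+ m) ⟩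
  + m                      ∎
  where
  open ℤ.≤-Reasoning
  i+j-i≡j : ∀ i j → i ℤ.+ j ℤ.+ ℤ.- i ≡ j
  i+j-i≡j = ℤ-Solver.solve-∀

lemma14 : (a b c r s : ℕ) → 1 < a → 1 < b → 0 < c → 0 < r → 0 < s →
          gcd (r * a) (s * b) ≡ 1 →
          (x₁ y₁ u₁ v₁ x₂ y₂ u₂ v₂ : ℕ) →
          u₁ ≤ 1 → v₁ ≤ 1 → u₂ ≤ 1 → v₂ ≤ 1 →
          IsSol a b c r s x₁ y₁ u₁ v₁ → IsSol a b c r s x₂ y₂ u₂ v₂ →
          x₁ < x₂ →
          ((1 < r ⊎ 0 < x₁) → c < 2 * (r * a ^ x₂))
          × ((r ≡ 1 × x₁ ≡ 0) → (+ c) - (+ 2) ℤ.< (+ 2) ℤ.* (+ (a ^ x₂)))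
lemma14 a b c r s 1<a _ 0<c 0<r _ gcd≡1 x₁ y₁ u₁ v₁ x₂ y₂ u₂ v₂ u₁≤1 v₁≤1 u₂≤1 v₂≤1 sol₁ sol₂ x₁<x₂ =
  part₁ , part₂
  where
  Q = r * a ^ x₂
  A = a ^ (x₂ ∸ x₁)
  2≤A : 2 ≤ A
  2≤A = ^-monoʳ-< a 1<a (m<n⇒0<n∸m x₁<x₂)
  Q≡P*A : Q ≡ r * a ^ x₁ * A
  Q≡P*A = *-^-∸ r a (<⇒≤ x₁<x₂)
  cop : ∀ y → Coprime (s * b ^ y) (r * a ^ x₁)
  cop = coprime-*^ {r} {a} {s} {b} (gcd≡1⇒coprime gcd≡1) x₁
  signed : ∀ x y {u v} → u ≤ 1 → v ≤ 1 → IsSol a b c r s x y u v →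
           SignedSum (r * a ^ x) (s * b ^ y) c
  signed x y u≤1 v≤1 = isSol⇒signedSum {a} {b} {c} {r} {s} {x} {y} u≤1 v≤1 0<c
  c≤Q+1+A : c ≤ Q + suc A
  c≤Q+1+A = subst (λ Q → c ≤ Q + suc A) (sym Q≡P*A)
    (signedSums-bound 2≤A (*^-∣-total s b y₁ y₂) (cop y₁) (cop y₂)
      (signed x₁ y₁ u₁≤1 v₁≤1 sol₁)
      (subst (λ Q → SignedSum Q (s * b ^ y₂) c) Q≡P*A (signed x₂ y₂ u₂≤1 v₂≤1 sol₂)))
  part₁ : 1 < r ⊎ 0 < x₁ → c < 2 * Q
  part₁ h = begin-strict
    c          ≤⟨ c≤Q+1+A ⟩
    Q + suc A  <⟨ +-monoʳ-< Q (subst (suc A <_) (sym Q≡P*A) (1+n<m*n (2≤r*a^x 0<r 1<a h) 2≤A)) ⟩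
    Q + Q      ≡⟨ cong (λ k → Q + k) (+-identityʳ Q) ⟨
    2 * Q      ∎
    where open ≤-Reasoning
  part₂ : r ≡ 1 × x₁ ≡ 0 → + c - + 2 ℤ.< + 2 ℤ.* + (a ^ x₂)
  part₂ (refl , refl) = subst (+ c - + 2 ℤ.<_) (ℤ.pos-* 2 A)
    (n<k+m⇒n-k<m (s≤s (≤-trans c≤Q+1+A (≤-reflexive (1*n+1+n≡1+2*n A)))))
    where
    1*n+1+n≡1+2*n : ∀ n → 1 * n + suc n ≡ suc (2 * n)
    1*n+1+n≡1+2*n = solve-∀
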